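{- Let $n\ge 3$ and let $G$ be the crown graph on $2n$ vertices. Then every vertex $v$ of $G$ has betweenness centrality $C_B(v)=\frac{n+1}{2}$.
   Context: The crown graph on $2n$ vertices has vertex set $\{u_1,\dots,u_n,v_1,\dots,v_n\}$ and an edge $u_iv_j$ exactly when $i\neq j$ (no other edges); i.e. it is $K_{n,n}$ minus a perfect matching. For a connected graph $G$ and a vertex $v$, the betweenness centrality is $C_B(v)=\sum \frac{\sigma_{st}(v)}{\sigma_{st}}$, the sum running over all unordered pairs $\{s,t\}$ of distinct vertices of $G$ with $s\neq v\neq t$, where $\sigma_{st}$ is the number of shortest paths (geodesics) between $s$ and $t$ and $\sigma_{st}(v)$ is the number of those shortest paths that pass through $v$ (as an intermediate vertex). -}

module Defs where

open import Data.Bool using (Bool; true; false; if_then_else_; not; _∧_)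
open import Data.Nat using (ℕ; zero; suc; _<ᵇ_)
open import Data.Fin as Fin using (Fin; toℕ; splitAt)
open import Data.Sum using (inj₁; inj₂)
open import Data.List using (List; []; _∷_; [_]; map; concatMap; allFin; filterᵇ; length; foldr)
open import Data.Bool.ListAction using (any)
open import Data.Integer using (+_)
open import Data.Rational using (ℚ; 0ℚ; _/_; _+_)
open import Relation.Nullary using (does)

-- A finite simple graph on the vertex set Fin m, given by a (symmetric,
-- irreflexive) Boolean adjacency function.
Adj : ℕ → Set
Adj m = Fin m → Fin m → Bool

_==_ : ∀ {m} → Fin m → Fin m → Bool
i == j = does (i Fin.≟ j)

-- Crown graph on 2n vertices: vertex set Fin (n + n); index i < n is u_i,
-- index n + j is v_j (via splitAt).  u_i ~ v_j iff i ≠ j; no other edges.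
crown : (n : ℕ) → Adj (n Data.Nat.+ n)
crown n x y with splitAt n x | splitAt n y
... | inj₁ i | inj₂ j = not (i == j)
... | inj₂ j | inj₁ i = not (i == j)
... | inj₁ _ | inj₁ _ = false
... | inj₂ _ | inj₂ _ = false

module _ {m : ℕ} (adj : Adj m) where

  walks : ℕ → Fin m → Fin m → List (List (Fin m))
  walks zero    s t = if s == t then [ [ s ] ] else []
  walks (suc k) s t =
    concatMap (λ u → if adj s u then map (s ∷_) (walks k u t) else []) (allFin m)

  nonEmpty : ∀ {A : Set} → List A → Bool
  nonEmpty []      = false
  nonEmpty (_ ∷ _) = true

  search : ℕ → ℕ → Fin m → Fin m → ℕ
  search zero       k s t = k
  search (suc fuel) k s t = if nonEmpty (walks k s t) then k else search fuel (suc k) s t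

  -- graph distance d(s,t) (a shortest walk has length < m)
  dist : Fin m → Fin m → ℕ
  dist s t = search m 0 s t

  geodesics : Fin m → Fin m → List (List (Fin m))
  geodesics s t = walks (dist s t) s t

  σ : Fin m → Fin m → ℕ
  σ s t = length (geodesics s t)

  dropLast : List (Fin m) → List (Fin m)
  dropLast []           = []
  dropLast (x ∷ [])     = []
  dropLast (x ∷ y ∷ xs) = x ∷ dropLast (y ∷ xs)

  inner : List (Fin m) → List (Fin m)
  inner []       = []
  inner (x ∷ xs) = dropLast xs

  σ-via : Fin m → Fin m → Fin m → ℕ
  σ-via s t v = length (filterᵇ (λ w → any (_== v) (inner w)) (geodesics s t))

  -- a / b as a rational (0 when b = 0, which never happens for connected graphs)
  frac : ℕ → ℕ → ℚ
  frac a zero    = 0ℚ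
  frac a (suc b) = (+ a) / suc b

  sumℚ : List ℚ → ℚ
  sumℚ = foldr _+_ 0ℚ


  betweenness : Fin m → ℚ
  betweenness v =
    sumℚ (concatMap (λ s → concatMap (λ t →
             if (toℕ s <ᵇ toℕ t) ∧ not (s == v) ∧ not (t == v)
             then [ frac (σ-via s t v) (σ s t) ] else [])
           (allFin m)) (allFin m))

module Submission where

-- In the crown graph with n ≥ 3, u_i and v_j are adjacent for i ≠ j, two vertices on the same side
-- have exactly n - 2 common neighbours, and u_i, v_i are at distance 3, joined by the (n-1)(n-2)
-- geodesics u_i v_k u_l v_i.  So a vertex v lies inside a geodesic between s and t only when s, t
-- are distinct neighbours of v, or when {s, t} = {u_i, v_i} with i different from the index of v.
-- The first kind contributes 1/(n-2) for each of the (n-1)(n-2)/2 pairs of neighbours, the second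
-- (n-2)/((n-1)(n-2)) = 1/(n-1) for each of the n - 1 indices, and (n-1)/2 + 1 = (n+1)/2.
-- Since σ counts shortest walks, the geodesics are counted with the recurrences for walks of length
-- at most 3, and the sum is evaluated over the common denominator 2(n-1)(n-2).

open import Defs
open import Data.Bool using (Bool; true; false; if_then_else_; not; _∧_)
open import Data.Bool.ListAction using (any)
open import Data.Bool.Properties using (∧-identityʳ; not-injective)
open import Data.Fin as Fin using (Fin; toℕ; _↑ˡ_; _↑ʳ_; splitAt; punchIn)
open import Data.Fin.Properties
  using (toℕ-injective; punchInᵢ≢i; splitAt-↑ˡ; splitAt-↑ʳ; join-splitAt; ↑ˡ-injective; ↑ʳ-injective; toℕ-↑ˡ; toℕ-↑ʳ; toℕ<n)
import Data.Integer as ℤ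
import Data.Integer.Properties as ℤ
import Data.Integer.Tactic.RingSolver as ℤ-Solver
open import Data.List using (List; []; _∷_; [_]; _++_; map; concatMap; tabulate; allFin; filterᵇ; length; foldr)
open import Data.List.Properties using (length-++; filter-++)
open import Data.List.Relation.Unary.All using (All; []; _∷_; universal)
open import Data.List.Relation.Unary.All.Properties using (concat⁺; map⁺; tabulate⁺)
open import Data.Nat as ℕ using (ℕ; zero; suc; _+_; _*_; _≤_; s≤s; _<ᵇ_)
import Data.Nat.Properties as ℕ
open import Data.Nat.Tactic.RingSolver using (solve-∀)
open import Data.Product using (∃-syntax; _,_)
open import Data.Rational as ℚ using (ℚ; 0ℚ; _/_; toℚᵘ)
import Data.Rational.Properties as ℚ
open import Data.Rational.Unnormalised as ℚᵘ using (mkℚᵘ; *≡*)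
import Data.Rational.Unnormalised.Properties as ℚᵘ
open import Data.Sum using (inj₁; inj₂; [_,_]′)
open import Function using (_∘_; id)
open import Relation.Binary.Definitions using (tri<; tri≈; tri>)
open import Relation.Binary.PropositionalEquality hiding ([_])
open import Relation.Nullary using (Dec; yes; no; contradiction)
open import Relation.Nullary.Decidable using (T?; dec-true; dec-false)
open import Algebra.Properties.CommutativeMonoid.Sum ℕ.+-0-commutativeMonoid
  using (sum; sum-cong-≗; ∑-distrib-+; ∑-comm; sum-remove; sum-replicate-zero)
open import Algebra.Properties.Semiring.Sum ℕ.+-*-semiring using (*-distribʳ-sum)
open ≡-Reasoning

infixr 8 [_]·_

[_]·_ : Bool → ℕ → ℕ
[ b ]· x = if b then x else 0

[_]·0 : ∀ b → [ b ]· 0 ≡ 0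
[ true  ]·0 = refl
[ false ]·0 = refl

[]·-distrib-weights : ∀ c a b p x y →
  [ c ]· ([ a ]· [ b ]· x + [ p ]· y) ≡ [ c ]· [ a ]· [ b ]· 1 * x + [ c ]· [ p ]· 1 * y
[]·-distrib-weights false _ _ _ _ _ = refl
[]·-distrib-weights true  a b p x y = cong₂ _+_ (two a b) (one p y)
  where
  one : ∀ b z → [ b ]· z ≡ [ b ]· 1 * z
  one true  z = sym (ℕ.*-identityˡ z)
  one false z = refl
  two : ∀ a b → [ a ]· [ b ]· x ≡ [ a ]· [ b ]· 1 * x
  two true  b = one b x
  two false b = refl

==-refl : ∀ {m} (i : Fin m) → (i == i) ≡ true
==-refl i = dec-true (i Fin.≟ i) refl

==-false : ∀ {m} {i j : Fin m} → i ≢ j → (i == j) ≡ false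
==-false {i = i} {j} = dec-false (i Fin.≟ j)

==-false⇒≢ : ∀ {m} {i j : Fin m} → (i == j) ≡ false → i ≢ j
==-false⇒≢ {i = i} i≠i refl with () ← trans (sym i≠i) (==-refl i)

==-sym : ∀ {m} (i j : Fin m) → (i == j) ≡ (j == i)
==-sym i j with i Fin.≟ j
... | yes refl = sym (==-refl i)
... | no  i≢j  = sym (==-false (i≢j ∘ sym))

<ᵇ⇒≢ : ∀ {m} {s t : Fin m} → (toℕ s <ᵇ toℕ t) ≡ true → s ≢ t
<ᵇ⇒≢ {s = s} s<t refl with () ← trans (sym s<t) (dec-false (_ ℕ.<? _) (ℕ.<-irrefl {toℕ s} refl))

sum-const : ∀ n x → sum {n} (λ _ → x) ≡ n * x
sum-const zero    x = refl
sum-const (suc n) x = cong (x +_) (sum-const n x)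

sum-zero : ∀ {n} {f : Fin n → ℕ} → (∀ i → f i ≡ 0) → sum f ≡ 0
sum-zero {n} f≡0 = trans (sum-cong-≗ f≡0) (sum-replicate-zero n)

sum-*ʳ : ∀ {n} (f : Fin n → ℕ) c → sum (λ i → f i * c) ≡ sum f * c
sum-*ʳ f c = sym (*-distribʳ-sum c f)

sum-++ : ∀ m {n} (f : Fin (m + n) → ℕ) →
         sum f ≡ sum (λ i → f (i ↑ˡ n)) + sum (λ j → f (m ↑ʳ j))
sum-++ zero    f = refl
sum-++ (suc m) f = trans (cong (f Fin.zero +_) (sum-++ m (λ i → f (Fin.suc i))))
                         (sym (ℕ.+-assoc (f Fin.zero) _ _))

sum₂-linear : ∀ {m} (f g : Fin m → Fin m → ℕ) x y →
  sum (λ s → sum (λ t → f s t * x + g s t * y)) ≡ sum (λ s → sum (f s)) * x + sum (λ s → sum (g s)) * y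
sum₂-linear f g x y = begin
  sum (λ s → sum (λ t → f s t * x + g s t * y))
    ≡⟨ sum-cong-≗ (λ s → ∑-distrib-+ (λ t → f s t * x) (λ t → g s t * y)) ⟩
  sum (λ s → sum (λ t → f s t * x) + sum (λ t → g s t * y))
    ≡⟨ sum-cong-≗ (λ s → cong₂ _+_ (sum-*ʳ (f s) x) (sum-*ʳ (g s) y)) ⟩
  sum (λ s → sum (f s) * x + sum (g s) * y)
    ≡⟨ ∑-distrib-+ (λ s → sum (f s) * x) (λ s → sum (g s) * y) ⟩
  sum (λ s → sum (f s) * x) + sum (λ s → sum (g s) * y)
    ≡⟨ cong₂ _+_ (sum-*ʳ (λ s → sum (f s)) x) (sum-*ʳ (λ s → sum (g s)) y) ⟩
  sum (λ s → sum (f s)) * x + sum (λ s → sum (g s)) * y ∎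

sum-indicator : ∀ {n} (a : Fin n) x → sum (λ i → [ i == a ]· x) ≡ x
sum-indicator {suc n} a x = begin
  sum (λ i → [ i == a ]· x)
    ≡⟨ sum-remove {i = a} (λ i → [ i == a ]· x) ⟩
  [ a == a ]· x + sum (λ j → [ punchIn a j == a ]· x)
    ≡⟨ cong₂ _+_ (cong ([_]· x) (==-refl a)) (sum-zero off-a) ⟩
  x + 0
    ≡⟨ ℕ.+-identityʳ x ⟩
  x ∎
  where
  off-a : ∀ j → [ punchIn a j == a ]· x ≡ 0
  off-a j rewrite ==-false (punchInᵢ≢i a j) = refl

sum-except : ∀ {n} (a : Fin (suc n)) x → sum (λ i → [ not (i == a) ]· x) ≡ n * x
sum-except {n} a x = begin
  sum (λ i → [ not (i == a) ]· x)
    ≡⟨ sum-remove {i = a} (λ i → [ not (i == a) ]· x) ⟩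
  [ not (a == a) ]· x + sum (λ j → [ not (punchIn a j == a) ]· x)
    ≡⟨ cong₂ _+_ (cong (λ b → [ not b ]· x) (==-refl a)) (sum-cong-≗ off-a) ⟩
  sum {n} (λ _ → x)
    ≡⟨ sum-const n x ⟩
  n * x ∎
  where
  off-a : ∀ j → [ not (punchIn a j == a) ]· x ≡ x
  off-a j rewrite ==-false (punchInᵢ≢i a j) = refl

sum-except′ : ∀ {n} (a : Fin (suc n)) x → sum (λ i → [ not (a == i) ]· x) ≡ n * x
sum-except′ a x = trans (sum-cong-≗ (λ i → cong (λ b → [ not b ]· x) (==-sym a i))) (sum-except a x)

strict-order-split : ∀ {m} (s t : Fin m) x →
  [ toℕ s <ᵇ toℕ t ]· x + [ toℕ t <ᵇ toℕ s ]· x ≡ [ not (s == t) ]· x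
strict-order-split s t x with ℕ.<-cmp (toℕ s) (toℕ t)
... | tri< s<t _ s≯t rewrite dec-true (_ ℕ.<? _) s<t | dec-false (_ ℕ.<? _) s≯t
                           | ==-false (ℕ.<⇒≢ s<t ∘ cong toℕ) = ℕ.+-identityʳ x
... | tri> s≮t _ s>t rewrite dec-false (_ ℕ.<? _) s≮t | dec-true (_ ℕ.<? _) s>t
                           | ==-false (ℕ.>⇒≢ s>t ∘ cong toℕ) = refl
... | tri≈ s≮t s≡t _ rewrite toℕ-injective s≡t | dec-false (_ ℕ.<? _) s≮t | ==-refl t = refl

sum-ordered-pairs : ∀ {m} (f : Fin m → Fin m → ℕ) → (∀ s t → f s t ≡ f t s) →
  sum (λ s → sum (λ t → [ toℕ s <ᵇ toℕ t ]· f s t)) * 2 ≡ sum (λ s → sum (λ t → [ not (s == t) ]· f s t))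
sum-ordered-pairs f f-sym = begin
  X * 2
    ≡⟨ ℕ.*-comm X 2 ⟩
  X + (X + 0)
    ≡⟨ cong (X +_) (ℕ.+-identityʳ X) ⟩
  X + X
    ≡⟨ cong (X +_) (∑-comm (λ s t → [ toℕ s <ᵇ toℕ t ]· f s t)) ⟩
  X + sum (λ s → sum (λ t → [ toℕ t <ᵇ toℕ s ]· f t s))
    ≡⟨ cong (X +_) (sum-cong-≗ (λ s → sum-cong-≗ (λ t → cong ([ toℕ t <ᵇ toℕ s ]·_) (f-sym t s)))) ⟩
  X + sum (λ s → sum (λ t → [ toℕ t <ᵇ toℕ s ]· f s t))
    ≡⟨ ∑-distrib-+ (λ s → sum (λ t → [ toℕ s <ᵇ toℕ t ]· f s t)) _ ⟨
  sum (λ s → sum (λ t → [ toℕ s <ᵇ toℕ t ]· f s t) + sum (λ t → [ toℕ t <ᵇ toℕ s ]· f s t))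
    ≡⟨ sum-cong-≗ (λ s → ∑-distrib-+ (λ t → [ toℕ s <ᵇ toℕ t ]· f s t) _) ⟨
  sum (λ s → sum (λ t → [ toℕ s <ᵇ toℕ t ]· f s t + [ toℕ t <ᵇ toℕ s ]· f s t))
    ≡⟨ sum-cong-≗ (λ s → sum-cong-≗ (λ t → strict-order-split s t (f s t))) ⟩
  sum (λ s → sum (λ t → [ not (s == t) ]· f s t)) ∎
  where
  X : ℕ
  X = sum (λ s → sum (λ t → [ toℕ s <ᵇ toℕ t ]· f s t))

-- Counting walks

count : ∀ {A : Set} → (A → Bool) → List A → ℕ
count p xs = length (filterᵇ p xs)

count-true : ∀ {A : Set} (xs : List A) → count (λ _ → true) xs ≡ length xs
count-true []       = refl
count-true (x ∷ xs) = cong suc (count-true xs)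

count-step : ∀ {A : Set} (p : List A → Bool) b (s : A) ws →
  count p (if b then map (s ∷_) ws else []) ≡ [ b ]· count (p ∘ (s ∷_)) ws
count-step p false s ws = refl
count-step p true  s []       = refl
count-step p true  s (w ∷ ws) with p (s ∷ w)
... | true  = cong suc (count-step p true s ws)
... | false = count-step p true s ws

length-concatMap-tabulate : ∀ {A B : Set} {n} (f : A → List B) (g : Fin n → A) →
  length (concatMap f (tabulate g)) ≡ sum (λ i → length (f (g i)))
length-concatMap-tabulate {n = zero}  f g = refl
length-concatMap-tabulate {n = suc n} f g =
  trans (length-++ (f (g Fin.zero))) (cong (length (f (g Fin.zero)) +_) (length-concatMap-tabulate f (λ i → g (Fin.suc i))))

filter-concatMap : ∀ {A B : Set} (p : B → Bool) (f : A → List B) xs →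
  filterᵇ p (concatMap f xs) ≡ concatMap (λ x → filterᵇ p (f x)) xs
filter-concatMap p f []       = refl
filter-concatMap p f (x ∷ xs) =
  trans (filter-++ (T? ∘ p) (f x) _) (cong (filterᵇ p (f x) ++_) (filter-concatMap p f xs))

dependency : ∀ {m} → Adj m → Fin m → Fin m → Fin m → ℚ
dependency adj v s t = frac adj (σ-via adj s t v) (σ adj s t)

module WalkCounts {m : ℕ} (adj : Adj m) where

  #walks : ℕ → Fin m → Fin m → ℕ
  #walks k s t = length (walks adj k s t)

  visits : Fin m → List (Fin m) → Bool
  visits v w = any (_== v) w

  #via : Fin m → ℕ → Fin m → Fin m → ℕ
  #via v k s t = count (visits v ∘ inner adj) (walks adj k s t)

  #via⁺ : Fin m → ℕ → Fin m → Fin m → ℕ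
  #via⁺ v k s t = count (visits v ∘ dropLast adj) (walks adj k s t)

  count-walks-suc : ∀ (p : List (Fin m) → Bool) k s t →
    count p (walks adj (suc k) s t) ≡ sum (λ u → [ adj s u ]· count (p ∘ (s ∷_)) (walks adj k u t))
  count-walks-suc p k s t = begin
    count p (walks adj (suc k) s t)                     ≡⟨ cong length (filter-concatMap p step (allFin m)) ⟩
    length (concatMap (filterᵇ p ∘ step) (allFin m))    ≡⟨ length-concatMap-tabulate (filterᵇ p ∘ step) id ⟩
    sum (λ u → count p (step u))                         ≡⟨ sum-cong-≗ (λ u → count-step p (adj s u) s (walks adj k u t)) ⟩
    sum (λ u → [ adj s u ]· count (p ∘ (s ∷_)) (walks adj k u t)) ∎
    where
    step : Fin m → List (List (Fin m))
    step u = if adj s u then map (s ∷_) (walks adj k u t) else []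

  dependency-at-distance : ∀ v s t r → dist adj s t ≡ r →
    dependency adj v s t ≡ frac adj (#via v r s t) (#walks r s t)
  dependency-at-distance v s t r = cong (λ d → frac adj (#via v d s t) (#walks d s t))

  #walks-zero : ∀ s t → #walks 0 s t ≡ [ s == t ]· 1
  #walks-zero s t with s == t
  ... | true  = refl
  ... | false = refl

  #walks-suc : ∀ k s t → #walks (suc k) s t ≡ sum (λ u → [ adj s u ]· #walks k u t)
  #walks-suc k s t = begin
    #walks (suc k) s t
      ≡⟨ count-true (walks adj (suc k) s t) ⟨
    count (λ _ → true) (walks adj (suc k) s t)
      ≡⟨ count-walks-suc (λ _ → true) k s t ⟩
    sum (λ u → [ adj s u ]· count (λ _ → true) (walks adj k u t))
      ≡⟨ sum-cong-≗ (λ u → cong ([ adj s u ]·_) (count-true (walks adj k u t))) ⟩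
    sum (λ u → [ adj s u ]· #walks k u t) ∎

  StartsAt : Fin m → List (Fin m) → Set
  StartsAt x w = ∃[ rest ] w ≡ x ∷ rest

  walks-start : ∀ k s t → All (StartsAt s) (walks adj k s t)
  walks-start zero    s t with s == t
  ... | true  = (_ , refl) ∷ []
  ... | false = []
  walks-start (suc k) s t = concat⁺ (map⁺ (tabulate⁺ from))
    where
    from : ∀ u → All (StartsAt s) (if adj s u then map (s ∷_) (walks adj k u t) else [])
    from u with adj s u
    ... | true  = map⁺ (universal (λ w → w , refl) (walks adj k u t))
    ... | false = []

  count-prefix : ∀ v u x (ws : List (List (Fin m))) → All (StartsAt x) ws →
    count (visits v ∘ dropLast adj ∘ (u ∷_)) ws ≡ (if u == v then length ws else count (visits v ∘ dropLast adj) ws)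
  count-prefix v u x [] [] with u == v
  ... | true  = refl
  ... | false = refl
  count-prefix v u x ((x ∷ rest) ∷ ws) ((_ , refl) ∷ ws-start) with u == v | count-prefix v u x ws ws-start
  ... | true  | ih = cong suc ih
  ... | false | ih with visits v (dropLast adj (x ∷ rest))
  ...   | true  = cong suc ih
  ...   | false = ih

  #via-suc : ∀ v k s t → #via v (suc k) s t ≡ sum (λ u → [ adj s u ]· #via⁺ v k u t)
  #via-suc v = count-walks-suc (visits v ∘ inner adj)

  #via⁺-suc : ∀ v k u t → #via⁺ v (suc k) u t ≡ (if u == v then #walks (suc k) u t else #via v (suc k) u t)
  #via⁺-suc v k u t = begin
    #via⁺ v (suc k) u t                                          ≡⟨ count-walks-suc (visits v ∘ dropLast adj) k u t ⟩
    sum (λ x → [ adj u x ]· count (visits v ∘ dropLast adj ∘ (u ∷_)) (walks adj k x t))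
      ≡⟨ sum-cong-≗ (λ x → cong ([ adj u x ]·_) (count-prefix v u x (walks adj k x t) (walks-start k x t))) ⟩
    sum (λ x → [ adj u x ]· (if u == v then #walks k x t else #via⁺ v k x t)) ≡⟨ by-cases (u == v) ⟩
    (if u == v then #walks (suc k) u t else #via v (suc k) u t)  ∎
    where
    by-cases : ∀ b → sum (λ x → [ adj u x ]· (if b then #walks k x t else #via⁺ v k x t))
                   ≡ (if b then #walks (suc k) u t else #via v (suc k) u t)
    by-cases true  = sym (#walks-suc k u t)
    by-cases false = sym (#via-suc v k u t)

  #walks-one : ∀ s t → #walks 1 s t ≡ [ adj s t ]· 1
  #walks-one s t = begin
    #walks 1 s t                          ≡⟨ #walks-suc 0 s t ⟩
    sum (λ u → [ adj s u ]· #walks 0 u t) ≡⟨ sum-cong-≗ at ⟩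
    sum (λ u → [ u == t ]· [ adj s t ]· 1) ≡⟨ sum-indicator t _ ⟩
    [ adj s t ]· 1                        ∎
    where
    at : ∀ u → [ adj s u ]· #walks 0 u t ≡ [ u == t ]· [ adj s t ]· 1
    at u rewrite #walks-zero u t with u Fin.≟ t
    ... | yes refl = refl
    ... | no _     with adj s u
    ...   | true  = refl
    ...   | false = refl

  #walks-two : ∀ s t → #walks 2 s t ≡ sum (λ u → [ adj s u ]· [ adj u t ]· 1)
  #walks-two s t = trans (#walks-suc 1 s t) (sum-cong-≗ (λ u → cong ([ adj s u ]·_) (#walks-one u t)))

  #via-one : ∀ v s t → #via v 1 s t ≡ 0
  #via-one v s t = trans (#via-suc v 0 s t) (sum-zero none)
    where
    none : ∀ u → [ adj s u ]· #via⁺ v 0 u t ≡ 0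
    none u with u == t | adj s u
    ... | _     | false = refl
    ... | true  | true  = refl
    ... | false | true  = refl

  #via-suc-suc : ∀ v k s t → #via v (2 + k) s t ≡
    sum (λ u → [ adj s u ]· (if u == v then #walks (suc k) u t else #via v (suc k) u t))
  #via-suc-suc v k s t = trans (#via-suc v (suc k) s t) (sum-cong-≗ (λ u → cong ([ adj s u ]·_) (#via⁺-suc v k u t)))

  #via-two : ∀ v s t → #via v 2 s t ≡ [ adj s v ]· [ adj v t ]· 1
  #via-two v s t = begin
    #via v 2 s t ≡⟨ #via-suc-suc v 0 s t ⟩
    sum (λ u → [ adj s u ]· (if u == v then #walks 1 u t else #via v 1 u t)) ≡⟨ sum-cong-≗ at ⟩
    sum (λ u → [ u == v ]· [ adj s v ]· [ adj v t ]· 1)                        ≡⟨ sum-indicator v _ ⟩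
    [ adj s v ]· [ adj v t ]· 1                                                ∎
    where
    at : ∀ u → [ adj s u ]· (if u == v then #walks 1 u t else #via v 1 u t) ≡ [ u == v ]· [ adj s v ]· [ adj v t ]· 1
    at u with u Fin.≟ v
    ... | yes refl = cong ([ adj s u ]·_) (#walks-one u t)
    ... | no _     rewrite #via-one v u t with adj s u
    ...   | true  = refl
    ...   | false = refl

  #via-three : ∀ v → adj v v ≡ false → ∀ s t →
    #via v 3 s t ≡ [ adj s v ]· #walks 2 v t + [ adj v t ]· #walks 2 s v
  #via-three v irreflexive s t = begin
    #via v 3 s t ≡⟨ #via-suc-suc v 1 s t ⟩
    sum (λ u → [ adj s u ]· (if u == v then #walks 2 u t else #via v 2 u t)) ≡⟨ sum-cong-≗ at ⟩
    sum (λ u → [ u == v ]· [ adj s v ]· #walks 2 v t + [ adj s u ]· [ adj u v ]· 1 * [ adj v t ]· 1)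
      ≡⟨ ∑-distrib-+ (λ u → [ u == v ]· [ adj s v ]· #walks 2 v t) (λ u → [ adj s u ]· [ adj u v ]· 1 * [ adj v t ]· 1) ⟩
    sum (λ u → [ u == v ]· [ adj s v ]· #walks 2 v t) + sum (λ u → [ adj s u ]· [ adj u v ]· 1 * [ adj v t ]· 1)
      ≡⟨ cong₂ _+_ (sum-indicator v _) (sum-*ʳ (λ u → [ adj s u ]· [ adj u v ]· 1) _) ⟩
    [ adj s v ]· #walks 2 v t + sum (λ u → [ adj s u ]· [ adj u v ]· 1) * [ adj v t ]· 1
      ≡⟨ cong (λ w → [ adj s v ]· #walks 2 v t + w * [ adj v t ]· 1) (#walks-two s v) ⟨
    [ adj s v ]· #walks 2 v t + #walks 2 s v * [ adj v t ]· 1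
      ≡⟨ cong ([ adj s v ]· #walks 2 v t +_) (*-[]·1 (#walks 2 s v) (adj v t)) ⟩
    [ adj s v ]· #walks 2 v t + [ adj v t ]· #walks 2 s v ∎
    where
    *-[]·1 : ∀ x b → x * [ b ]· 1 ≡ [ b ]· x
    *-[]·1 x true  = ℕ.*-identityʳ x
    *-[]·1 x false = ℕ.*-zeroʳ x
    at : ∀ u → [ adj s u ]· (if u == v then #walks 2 u t else #via v 2 u t)
             ≡ [ u == v ]· [ adj s v ]· #walks 2 v t + [ adj s u ]· [ adj u v ]· 1 * [ adj v t ]· 1
    at u with u Fin.≟ v
    ... | yes refl rewrite irreflexive with adj s u
    ...   | true  = sym (ℕ.+-identityʳ _)
    ...   | false = refl
    at u | no _ rewrite #via-two v u t with adj s u | adj u v | adj v t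
    ...   | false | _     | _     = refl
    ...   | true  | false | _     = refl
    ...   | true  | true  | true  = refl
    ...   | true  | true  | false = refl

  search-miss : ∀ f j s t → #walks j s t ≡ 0 → search adj (suc f) j s t ≡ search adj f (suc j) s t
  search-miss f j s t none with walks adj j s t | none
  ... | [] | _ = refl

  search-hit : ∀ f j s t {c} → #walks j s t ≡ suc c → search adj f j s t ≡ j
  search-hit zero    j s t some = refl
  search-hit (suc f) j s t some with walks adj j s t | some
  ... | _ ∷ _ | _ = refl

  no-trivial-walk : ∀ {s t} → s ≢ t → #walks 0 s t ≡ 0
  no-trivial-walk {s} {t} s≢t = trans (#walks-zero s t) (cong ([_]· 1) (==-false s≢t))

  no-edge-walk : ∀ {s t} → adj s t ≡ false → #walks 1 s t ≡ 0
  no-edge-walk {s} {t} no-edge = trans (#walks-one s t) (cong ([_]· 1) no-edge)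

-- dist searches with fuel m, and fuel 3 is enough to find distances up to 3.
module Distance {f : ℕ} (adj : Adj (3 + f)) {s t : Fin (3 + f)} (s≢t : s ≢ t) where
  open WalkCounts adj

  dist≡1 : adj s t ≡ true → dist adj s t ≡ 1
  dist≡1 edge = trans (search-miss (2 + f) 0 s t (no-trivial-walk s≢t))
                      (search-hit (2 + f) 1 s t (trans (#walks-one s t) (cong ([_]· 1) edge)))

  dist≡2 : ∀ {c} → adj s t ≡ false → #walks 2 s t ≡ suc c → dist adj s t ≡ 2
  dist≡2 no-edge some = trans (search-miss (2 + f) 0 s t (no-trivial-walk s≢t))
                       (trans (search-miss (1 + f) 1 s t (no-edge-walk no-edge)) (search-hit (1 + f) 2 s t some))

  dist≡3 : ∀ {c} → adj s t ≡ false → #walks 2 s t ≡ 0 → #walks 3 s t ≡ suc c → dist adj s t ≡ 3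
  dist≡3 no-edge none some = trans (search-miss (2 + f) 0 s t (no-trivial-walk s≢t))
                            (trans (search-miss (1 + f) 1 s t (no-edge-walk no-edge))
                            (trans (search-miss f 2 s t none) (search-hit f 3 s t some)))

-- Pairs of neighbours in a simple graph

counted : ∀ {m} → Fin m → Fin m → Fin m → Bool
counted v s t = (toℕ s <ᵇ toℕ t) ∧ not (s == v) ∧ not (t == v)

counted-ordered : ∀ {m} {v s t : Fin m} → counted v s t ≡ true → (toℕ s <ᵇ toℕ t) ≡ true
counted-ordered {s = s} {t} c with toℕ s <ᵇ toℕ t
... | true  = refl
... | false = c

counted-avoids : ∀ {m} {v s t : Fin m} → counted v s t ≡ true → (not (s == v) ∧ not (t == v)) ≡ true
counted-avoids {s = s} {t} c with toℕ s <ᵇ toℕ t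
... | true  = c
... | false with () ← c

degree : ∀ {m} → Adj m → Fin m → ℕ
degree adj v = sum (λ t → [ adj v t ]· 1)

module SimpleGraph {m : ℕ} (adj : Adj m)
                   (symmetric : ∀ s t → adj s t ≡ adj t s) (irreflexive : ∀ v → adj v v ≡ false) where

  distinct-neighbours-of : ∀ v {d} → degree adj v ≡ suc d → ∀ s →
    sum (λ t → [ not (s == t) ]· [ adj s v ]· [ adj v t ]· 1) ≡ [ adj v s ]· 1 * d
  distinct-neighbours-of v {d} deg s rewrite symmetric s v with adj v s in vs
  ... | false = sum-zero (λ t → [ not (s == t) ]·0)
  ... | true  = trans (ℕ.+-cancelʳ-≡ 1 _ _ (begin
    sum (λ t → [ not (s == t) ]· [ adj v t ]· 1) + 1
      ≡⟨ cong (sum (λ t → [ not (s == t) ]· [ adj v t ]· 1) +_) (sum-indicator s _) ⟨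
    sum (λ t → [ not (s == t) ]· [ adj v t ]· 1) + sum (λ t → [ t == s ]· 1)
      ≡⟨ ∑-distrib-+ (λ t → [ not (s == t) ]· [ adj v t ]· 1) _ ⟨
    sum (λ t → [ not (s == t) ]· [ adj v t ]· 1 + [ t == s ]· 1)  ≡⟨ sum-cong-≗ split-at-s ⟩
    degree adj v                                                   ≡⟨ deg ⟩
    suc d                                                          ≡⟨ ℕ.+-comm 1 d ⟩
    d + 1                                                          ∎)) (sym (ℕ.*-identityˡ d))
    where
    split-at-s : ∀ t → [ not (s == t) ]· [ adj v t ]· 1 + [ t == s ]· 1 ≡ [ adj v t ]· 1
    split-at-s t with t Fin.≟ s
    ... | yes refl rewrite ==-refl t | vs = refl
    ... | no  t≢s  rewrite ==-false (t≢s ∘ sym) = ℕ.+-identityʳ _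

  distinct-neighbour-pairs : ∀ v {d} → degree adj v ≡ suc d →
    sum (λ s → sum (λ t → [ not (s == t) ]· [ adj s v ]· [ adj v t ]· 1)) ≡ suc d * d
  distinct-neighbour-pairs v {d} deg = begin
    sum (λ s → sum (λ t → [ not (s == t) ]· [ adj s v ]· [ adj v t ]· 1)) ≡⟨ sum-cong-≗ (distinct-neighbours-of v deg) ⟩
    sum (λ s → [ adj v s ]· 1 * d)                                         ≡⟨ sum-*ʳ (λ s → [ adj v s ]· 1) d ⟩
    degree adj v * d                                                      ≡⟨ cong (_* d) deg ⟩
    suc d * d                                                             ∎

  counted-neighbours : ∀ v s t →
    [ counted v s t ]· [ adj s v ]· [ adj v t ]· 1 ≡ [ toℕ s <ᵇ toℕ t ]· [ adj s v ]· [ adj v t ]· 1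
  counted-neighbours v s t with s Fin.≟ v | t Fin.≟ v
  ... | yes refl | _        rewrite irreflexive s = trans ([ _ ]·0) (sym ([ _ ]·0))
  ... | no _     | yes refl rewrite irreflexive t with adj s t
  ...   | true  = trans ([ _ ]·0) (sym ([ _ ]·0))
  ...   | false = trans ([ _ ]·0) (sym ([ _ ]·0))
  counted-neighbours v s t | no _ | no _ =
    cong (λ c → [ c ]· [ adj s v ]· [ adj v t ]· 1) (∧-identityʳ (toℕ s <ᵇ toℕ t))

  neighbour-pair-symmetric : ∀ v s t → [ adj s v ]· [ adj v t ]· 1 ≡ [ adj t v ]· [ adj v s ]· 1
  neighbour-pair-symmetric v s t rewrite symmetric s v | symmetric v t with adj v s | adj t v
  ... | true  | true  = refl
  ... | true  | false = refl
  ... | false | true  = refl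
  ... | false | false = refl

  counted-neighbour-pairs : ∀ v {d} → degree adj v ≡ suc d →
    sum (λ s → sum (λ t → [ counted v s t ]· [ adj s v ]· [ adj v t ]· 1)) * 2 ≡ suc d * d
  counted-neighbour-pairs v {d} deg = begin
    sum (λ s → sum (λ t → [ counted v s t ]· [ adj s v ]· [ adj v t ]· 1)) * 2
      ≡⟨ cong (_* 2) (sum-cong-≗ (λ s → sum-cong-≗ (counted-neighbours v s))) ⟩
    sum (λ s → sum (λ t → [ toℕ s <ᵇ toℕ t ]· [ adj s v ]· [ adj v t ]· 1)) * 2
      ≡⟨ sum-ordered-pairs (λ s t → [ adj s v ]· [ adj v t ]· 1) (neighbour-pair-symmetric v) ⟩
    sum (λ s → sum (λ t → [ not (s == t) ]· [ adj s v ]· [ adj v t ]· 1))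
      ≡⟨ distinct-neighbour-pairs v deg ⟩
    suc d * d ∎

-- Betweenness over a common denominator

/-cross : ∀ a b c e → a * suc e ≡ b * suc c → (ℤ.+ a) / suc c ≡ (ℤ.+ b) / suc e
/-cross a b c e eq = ℚ.fromℚᵘ-cong {mkℚᵘ (ℤ.+ a) c} {mkℚᵘ (ℤ.+ b) e}
  (*≡* (trans (sym (ℤ.pos-* a (suc e))) (trans (cong ℤ.+_ eq) (ℤ.pos-* b (suc c)))))

Σℚ : List ℚ → ℚ
Σℚ = foldr ℚ._+_ 0ℚ

Σℚ-++ : ∀ xs ys → Σℚ (xs ++ ys) ≡ Σℚ xs ℚ.+ Σℚ ys
Σℚ-++ []       ys = sym (ℚ.+-identityˡ (Σℚ ys))
Σℚ-++ (x ∷ xs) ys = trans (cong (x ℚ.+_) (Σℚ-++ xs ys)) (sym (ℚ.+-assoc x (Σℚ xs) (Σℚ ys)))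

module CommonDenominator (d : ℕ) where

  toℚᵘ-/ : ∀ a → toℚᵘ ((ℤ.+ a) / suc d) ℚᵘ.≃ mkℚᵘ (ℤ.+ a) d
  toℚᵘ-/ a = ℚ.toℚᵘ-fromℚᵘ (mkℚᵘ (ℤ.+ a) d)

  /-+ : ∀ a b → (ℤ.+ a) / suc d ℚ.+ (ℤ.+ b) / suc d ≡ (ℤ.+ (a + b)) / suc d
  /-+ a b = ℚ.toℚᵘ-injective
    (ℚᵘ.≃-trans (ℚ.toℚᵘ-homo-+ ((ℤ.+ a) / suc d) ((ℤ.+ b) / suc d))
    (ℚᵘ.≃-trans (ℚᵘ.+-cong (toℚᵘ-/ a) (toℚᵘ-/ b))
    (ℚᵘ.≃-trans (*≡* same-denominator) (ℚᵘ.≃-sym (toℚᵘ-/ (a + b))))))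
    where
    same-denominator : ((ℤ.+ a) ℤ.* (ℤ.+ suc d) ℤ.+ (ℤ.+ b) ℤ.* (ℤ.+ suc d)) ℤ.* (ℤ.+ suc d)
                     ≡ (ℤ.+ (a + b)) ℤ.* ((ℤ.+ suc d) ℤ.* (ℤ.+ suc d))
    same-denominator rewrite ℤ.pos-+ a b = ℤ-solve (ℤ.+ a) (ℤ.+ b) (ℤ.+ suc d)
      where
      ℤ-solve : ∀ x y z → (x ℤ.* z ℤ.+ y ℤ.* z) ℤ.* z ≡ (x ℤ.+ y) ℤ.* (z ℤ.* z)
      ℤ-solve = ℤ-Solver.solve-∀

  Σℚ-guarded : ∀ c q x → (c ≡ true → q ≡ (ℤ.+ x) / suc d) →
    Σℚ (if c then [ q ] else []) ≡ (ℤ.+ [ c ]· x) / suc d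
  Σℚ-guarded false q x _  = sym (ℚ.0/n≡0 (suc d))
  Σℚ-guarded true  q x eq = trans (ℚ.+-identityʳ q) (eq refl)

  Σℚ-concatMap : ∀ {A : Set} {n} (F : A → List ℚ) (g : A → ℕ) (e : Fin n → A) →
    (∀ a → Σℚ (F a) ≡ (ℤ.+ g a) / suc d) → Σℚ (concatMap F (tabulate e)) ≡ (ℤ.+ sum (g ∘ e)) / suc d
  Σℚ-concatMap {n = zero}  F g e _  = sym (ℚ.0/n≡0 (suc d))
  Σℚ-concatMap {n = suc n} F g e eq = begin
    Σℚ (F (e Fin.zero) ++ concatMap F (tabulate (e ∘ Fin.suc)))
      ≡⟨ Σℚ-++ (F (e Fin.zero)) _ ⟩
    Σℚ (F (e Fin.zero)) ℚ.+ Σℚ (concatMap F (tabulate (e ∘ Fin.suc)))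
      ≡⟨ cong₂ ℚ._+_ (eq (e Fin.zero)) (Σℚ-concatMap F g (e ∘ Fin.suc) eq) ⟩
    (ℤ.+ g (e Fin.zero)) / suc d ℚ.+ (ℤ.+ sum (g ∘ e ∘ Fin.suc)) / suc d
      ≡⟨ /-+ (g (e Fin.zero)) _ ⟩
    (ℤ.+ sum (g ∘ e)) / suc d ∎

betweenness-as-fraction : ∀ {m} (adj : Adj m) v d (x : Fin m → Fin m → ℕ) →
  (∀ s t → counted v s t ≡ true → dependency adj v s t ≡ (ℤ.+ x s t) / suc d) →
  betweenness adj v ≡ (ℤ.+ sum (λ s → sum (λ t → [ counted v s t ]· x s t))) / suc d
betweenness-as-fraction adj v d x term =
  Σℚ-concatMap _ _ id λ s → Σℚ-concatMap _ _ id λ t → Σℚ-guarded (counted v s t) _ (x s t) (term s t)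
  where open CommonDenominator d

-- The crown graph

module CrownStructure (n : ℕ) where

  L R : Fin n → Fin (n + n)
  L i = i ↑ˡ n
  R j = n ↑ʳ j

  adj-LL : ∀ i j → crown n (L i) (L j) ≡ false
  adj-LL i j rewrite splitAt-↑ˡ n i n | splitAt-↑ˡ n j n = refl

  adj-LR : ∀ i j → crown n (L i) (R j) ≡ not (i == j)
  adj-LR i j rewrite splitAt-↑ˡ n i n | splitAt-↑ʳ n n j = refl

  adj-RL : ∀ i j → crown n (R i) (L j) ≡ not (i == j)
  adj-RL i j rewrite splitAt-↑ʳ n n i | splitAt-↑ˡ n j n = cong not (==-sym j i)

  adj-RR : ∀ i j → crown n (R i) (R j) ≡ false
  adj-RR i j rewrite splitAt-↑ʳ n n i | splitAt-↑ʳ n n j = refl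

  by-side : (P : Fin (n + n) → Set) → (∀ i → P (L i)) → (∀ j → P (R j)) → ∀ s → P s
  by-side P on-L on-R s = subst P (join-splitAt n n s) (on-part (splitAt n s))
    where
    on-part : ∀ x → P (Fin.join n n x)
    on-part (inj₁ i) = on-L i
    on-part (inj₂ j) = on-R j

  sum-by-side : (f : Fin (n + n) → ℕ) → sum f ≡ sum (f ∘ L) + sum (f ∘ R)
  sum-by-side = sum-++ n

  ==-LL : ∀ i j → (L i == L j) ≡ (i == j)
  ==-LL i j with i Fin.≟ j
  ... | yes refl = ==-refl (L i)
  ... | no  i≢j  = ==-false (i≢j ∘ ↑ˡ-injective n i j)

  ==-RR : ∀ i j → (R i == R j) ≡ (i == j)
  ==-RR i j with i Fin.≟ j
  ... | yes refl = ==-refl (R i)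
  ... | no  i≢j  = ==-false (i≢j ∘ ↑ʳ-injective n i j)

  toℕ-L<R : ∀ i j → toℕ (L i) ℕ.< toℕ (R j)
  toℕ-L<R i j = subst₂ ℕ._<_ (sym (toℕ-↑ˡ i n)) (sym (toℕ-↑ʳ n j)) (ℕ.<-≤-trans (toℕ<n i) (ℕ.m≤m+n n (toℕ j)))

  L<ᵇR : ∀ i j → (toℕ (L i) <ᵇ toℕ (R j)) ≡ true
  L<ᵇR i j = dec-true (_ ℕ.<? _) (toℕ-L<R i j)

  R≮ᵇL : ∀ i j → (toℕ (R i) <ᵇ toℕ (L j)) ≡ false
  R≮ᵇL i j = dec-false (_ ℕ.<? _) (ℕ.<⇒≯ (toℕ-L<R j i))

  L≢R : ∀ i j → L i ≢ R j
  L≢R i j = ℕ.<⇒≢ (toℕ-L<R i j) ∘ cong toℕ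

  ==-LR : ∀ i j → (L i == R j) ≡ false
  ==-LR i j = ==-false (L≢R i j)

  ==-RL : ∀ i j → (R i == L j) ≡ false
  ==-RL i j = ==-false (L≢R j i ∘ sym)

  crown-irreflexive : ∀ v → crown n v v ≡ false
  crown-irreflexive = by-side _ (λ i → adj-LL i i) (λ j → adj-RR j j)

  crown-symmetric : ∀ s t → crown n s t ≡ crown n t s
  crown-symmetric s t with splitAt n s | splitAt n t
  ... | inj₁ _ | inj₁ _ = refl
  ... | inj₁ _ | inj₂ _ = refl
  ... | inj₂ _ | inj₁ _ = refl
  ... | inj₂ _ | inj₂ _ = refl

  index : Fin (n + n) → Fin n
  index v = [ id , id ]′ (splitAt n v)

  index-L : ∀ i → index (L i) ≡ i
  index-L i rewrite splitAt-↑ˡ n i n = refl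

  index-R : ∀ j → index (R j) ≡ j
  index-R j rewrite splitAt-↑ʳ n n j = refl

  -- the pairs (u_i, v_i), which are the pairs at distance 3
  antipodal : Fin (n + n) → Fin (n + n) → Bool
  antipodal s t with splitAt n s | splitAt n t
  ... | inj₁ i | inj₂ j = i == j
  ... | _      | _      = false

  antipodal-LL : ∀ i j → antipodal (L i) (L j) ≡ false
  antipodal-LL i j rewrite splitAt-↑ˡ n i n | splitAt-↑ˡ n j n = refl

  antipodal-LR : ∀ i j → antipodal (L i) (R j) ≡ (i == j)
  antipodal-LR i j rewrite splitAt-↑ˡ n i n | splitAt-↑ʳ n n j = refl

  antipodal-R : ∀ i t → antipodal (R i) t ≡ false
  antipodal-R i t rewrite splitAt-↑ʳ n n i = refl

  antipodal-avoids : ∀ i v → (not (L i == v) ∧ not (R i == v)) ≡ not (i == index v)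
  antipodal-avoids i = by-side _ at-L at-R
    where
    at-L : ∀ a → (not (L i == L a) ∧ not (R i == L a)) ≡ not (i == index (L a))
    at-L a rewrite ==-LL i a | ==-RL i a | index-L a = ∧-identityʳ _
    at-R : ∀ a → (not (L i == R a) ∧ not (R i == R a)) ≡ not (i == index (R a))
    at-R a rewrite ==-LR i a | ==-RR i a | index-R a = refl

  no-two-step-across : ∀ i j v x → [ crown n (L i) v ]· [ crown n v (R j) ]· x ≡ 0
  no-two-step-across i j = by-side _ at-L at-R
    where
    at-L : ∀ a x → [ crown n (L i) (L a) ]· [ crown n (L a) (R j) ]· x ≡ 0
    at-L a x rewrite adj-LL i a = refl
    at-R : ∀ a x → [ crown n (L i) (R a) ]· [ crown n (R a) (R j) ]· x ≡ 0
    at-R a x rewrite adj-RR a j with crown n (L i) (R a)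
    ... | true  = refl
    ... | false = refl

module CrownGeodesics (k : ℕ) where

  n : ℕ
  n = 3 + k

  open CrownStructure n
  open WalkCounts (crown n)

  common-neighbours : ∀ (i j : Fin n) → i ≢ j → sum (λ l → [ not (i == l) ]· [ not (l == j) ]· 1) ≡ 1 + k
  common-neighbours i j i≢j = ℕ.+-cancelʳ-≡ 1 _ _ (begin
    sum (λ l → [ not (i == l) ]· [ not (l == j) ]· 1) + 1
      ≡⟨ cong (sum (λ l → [ not (i == l) ]· [ not (l == j) ]· 1) +_) (sum-indicator j 1) ⟨
    sum (λ l → [ not (i == l) ]· [ not (l == j) ]· 1) + sum (λ l → [ l == j ]· 1)
      ≡⟨ ∑-distrib-+ (λ l → [ not (i == l) ]· [ not (l == j) ]· 1) (λ l → [ l == j ]· 1) ⟨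
    sum (λ l → [ not (i == l) ]· [ not (l == j) ]· 1 + [ l == j ]· 1) ≡⟨ sum-cong-≗ split-at-j ⟩
    sum (λ l → [ not (i == l) ]· 1)                                   ≡⟨ sum-except′ i 1 ⟩
    (2 + k) * 1                                                      ≡⟨ ℕ.*-identityʳ (2 + k) ⟩
    2 + k                                                            ≡⟨ ℕ.+-comm 1 (1 + k) ⟩
    1 + k + 1                                                        ∎)
    where
    split-at-j : ∀ l → [ not (i == l) ]· [ not (l == j) ]· 1 + [ l == j ]· 1 ≡ [ not (i == l) ]· 1
    split-at-j l with l Fin.≟ j
    ... | yes refl rewrite ==-false i≢j = refl
    ... | no  _    = ℕ.+-identityʳ _

  #walks-two-LL : ∀ i j → i ≢ j → #walks 2 (L i) (L j) ≡ 1 + k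
  #walks-two-LL i j i≢j = begin
    #walks 2 (L i) (L j)                                                    ≡⟨ #walks-two (L i) (L j) ⟩
    sum (λ u → [ crown n (L i) u ]· [ crown n u (L j) ]· 1)
      ≡⟨ sum-by-side (λ u → [ crown n (L i) u ]· [ crown n u (L j) ]· 1) ⟩
    sum (λ l → [ crown n (L i) (L l) ]· [ crown n (L l) (L j) ]· 1)
      + sum (λ l → [ crown n (L i) (R l) ]· [ crown n (R l) (L j) ]· 1)     ≡⟨ cong₂ _+_ (sum-zero via-L) (sum-cong-≗ via-R) ⟩
    sum (λ l → [ not (i == l) ]· [ not (l == j) ]· 1)                       ≡⟨ common-neighbours i j i≢j ⟩
    1 + k                                                                   ∎
    where
    via-L : ∀ l → [ crown n (L i) (L l) ]· [ crown n (L l) (L j) ]· 1 ≡ 0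
    via-L l rewrite adj-LL i l = refl
    via-R : ∀ l → [ crown n (L i) (R l) ]· [ crown n (R l) (L j) ]· 1 ≡ [ not (i == l) ]· [ not (l == j) ]· 1
    via-R l rewrite adj-LR i l | adj-RL l j = refl

  #walks-two-RR : ∀ i j → i ≢ j → #walks 2 (R i) (R j) ≡ 1 + k
  #walks-two-RR i j i≢j = begin
    #walks 2 (R i) (R j)                                                    ≡⟨ #walks-two (R i) (R j) ⟩
    sum (λ u → [ crown n (R i) u ]· [ crown n u (R j) ]· 1)
      ≡⟨ sum-by-side (λ u → [ crown n (R i) u ]· [ crown n u (R j) ]· 1) ⟩
    sum (λ l → [ crown n (R i) (L l) ]· [ crown n (L l) (R j) ]· 1)
      + sum (λ l → [ crown n (R i) (R l) ]· [ crown n (R l) (R j) ]· 1)     ≡⟨ cong₂ _+_ (sum-cong-≗ via-L) (sum-zero via-R) ⟩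
    sum (λ l → [ not (i == l) ]· [ not (l == j) ]· 1) + 0                   ≡⟨ ℕ.+-identityʳ _ ⟩
    sum (λ l → [ not (i == l) ]· [ not (l == j) ]· 1)                       ≡⟨ common-neighbours i j i≢j ⟩
    1 + k                                                                   ∎
    where
    via-L : ∀ l → [ crown n (R i) (L l) ]· [ crown n (L l) (R j) ]· 1 ≡ [ not (i == l) ]· [ not (l == j) ]· 1
    via-L l rewrite adj-RL i l | adj-LR l j = refl
    via-R : ∀ l → [ crown n (R i) (R l) ]· [ crown n (R l) (R j) ]· 1 ≡ 0
    via-R l rewrite adj-RR i l = refl

  #walks-two-LR : ∀ i j → #walks 2 (L i) (R j) ≡ 0
  #walks-two-LR i j = begin
    #walks 2 (L i) (R j)                                                    ≡⟨ #walks-two (L i) (R j) ⟩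
    sum (λ u → [ crown n (L i) u ]· [ crown n u (R j) ]· 1)                 ≡⟨ sum-zero (λ u → no-two-step-across i j u 1) ⟩
    0                                                                       ∎

  #walks-three-antipodal : ∀ i → #walks 3 (L i) (R i) ≡ (2 + k) * (1 + k)
  #walks-three-antipodal i = begin
    #walks 3 (L i) (R i)                                                    ≡⟨ #walks-suc 2 (L i) (R i) ⟩
    sum (λ u → [ crown n (L i) u ]· #walks 2 u (R i))
      ≡⟨ sum-by-side (λ u → [ crown n (L i) u ]· #walks 2 u (R i)) ⟩
    sum (λ l → [ crown n (L i) (L l) ]· #walks 2 (L l) (R i))
      + sum (λ l → [ crown n (L i) (R l) ]· #walks 2 (R l) (R i))           ≡⟨ cong₂ _+_ (sum-zero via-L) (sum-cong-≗ via-R) ⟩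
    sum (λ l → [ not (i == l) ]· (1 + k))                                   ≡⟨ sum-except′ i (1 + k) ⟩
    (2 + k) * (1 + k)                                                       ∎
    where
    via-L : ∀ l → [ crown n (L i) (L l) ]· #walks 2 (L l) (R i) ≡ 0
    via-L l rewrite adj-LL i l = refl
    via-R : ∀ l → [ crown n (L i) (R l) ]· #walks 2 (R l) (R i) ≡ [ not (i == l) ]· (1 + k)
    via-R l rewrite adj-LR i l with i Fin.≟ l
    ... | yes refl = refl
    ... | no  i≢l  = #walks-two-RR l i (i≢l ∘ sym)

  #via-three-antipodal : ∀ i v → i ≢ index v → #via v 3 (L i) (R i) ≡ 1 + k
  #via-three-antipodal i v i≢v =
    trans (#via-three v (crown-irreflexive v) (L i) (R i)) (by-side (λ v → i ≢ index v → Via v ≡ 1 + k) at-L at-R v i≢v)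
    where
    Via : Fin (n + n) → ℕ
    Via v = [ crown n (L i) v ]· #walks 2 v (R i) + [ crown n v (R i) ]· #walks 2 (L i) v
    at-L : ∀ a → i ≢ index (L a) → Via (L a) ≡ 1 + k
    at-L a i≢a′ = begin
      Via (L a)
        ≡⟨ cong₂ _+_ (cong ([_]· #walks 2 (L a) (R i)) (adj-LL i a)) (cong ([_]· #walks 2 (L i) (L a)) (adj-LR a i)) ⟩
      [ not (a == i) ]· #walks 2 (L i) (L a)  ≡⟨ cong (λ b → [ not b ]· #walks 2 (L i) (L a)) (==-false (i≢a ∘ sym)) ⟩
      #walks 2 (L i) (L a)                    ≡⟨ #walks-two-LL i a i≢a ⟩
      1 + k                                   ∎
      where
      i≢a : i ≢ a
      i≢a = subst (i ≢_) (index-L a) i≢a′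
    at-R : ∀ a → i ≢ index (R a) → Via (R a) ≡ 1 + k
    at-R a i≢a′ = begin
      Via (R a)
        ≡⟨ cong₂ _+_ (cong ([_]· #walks 2 (R a) (R i)) (adj-LR i a)) (cong ([_]· #walks 2 (L i) (R a)) (adj-RR a i)) ⟩
      [ not (i == a) ]· #walks 2 (R a) (R i) + 0 ≡⟨ ℕ.+-identityʳ _ ⟩
      [ not (i == a) ]· #walks 2 (R a) (R i)     ≡⟨ cong (λ b → [ not b ]· #walks 2 (R a) (R i)) (==-false i≢a) ⟩
      #walks 2 (R a) (R i)                       ≡⟨ #walks-two-RR a i (i≢a ∘ sym) ⟩
      1 + k                                      ∎
      where
      i≢a : i ≢ a
      i≢a = subst (i ≢_) (index-R a) i≢a′

  crown-degree : ∀ v → degree (crown n) v ≡ 2 + k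
  crown-degree = by-side _ at-L at-R
    where
    at-L : ∀ a → degree (crown n) (L a) ≡ 2 + k
    at-L a = begin
      degree (crown n) (L a)                                                  ≡⟨ sum-by-side (λ t → [ crown n (L a) t ]· 1) ⟩
      sum (λ l → [ crown n (L a) (L l) ]· 1) + sum (λ l → [ crown n (L a) (R l) ]· 1)
        ≡⟨ cong₂ _+_ (sum-zero (λ l → cong ([_]· 1) (adj-LL a l))) (sum-cong-≗ (λ l → cong ([_]· 1) (adj-LR a l))) ⟩
      sum (λ l → [ not (a == l) ]· 1)                                         ≡⟨ sum-except′ a 1 ⟩
      (2 + k) * 1                                                             ≡⟨ ℕ.*-identityʳ (2 + k) ⟩
      2 + k                                                                   ∎
    at-R : ∀ a → degree (crown n) (R a) ≡ 2 + k
    at-R a = begin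
      degree (crown n) (R a)                                                  ≡⟨ sum-by-side (λ t → [ crown n (R a) t ]· 1) ⟩
      sum (λ l → [ crown n (R a) (L l) ]· 1) + sum (λ l → [ crown n (R a) (R l) ]· 1)
        ≡⟨ cong₂ _+_ (sum-cong-≗ (λ l → cong ([_]· 1) (adj-RL a l))) (sum-zero (λ l → cong ([_]· 1) (adj-RR a l))) ⟩
      sum (λ l → [ not (a == l) ]· 1) + 0                                     ≡⟨ ℕ.+-identityʳ _ ⟩
      sum (λ l → [ not (a == l) ]· 1)                                         ≡⟨ sum-except′ a 1 ⟩
      (2 + k) * 1                                                             ≡⟨ ℕ.*-identityʳ (2 + k) ⟩
      2 + k                                                                   ∎

module CrownBetweenness (k : ℕ) where

  open CrownGeodesics k
  open CrownStructure n
  open WalkCounts (crown n)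

  D-1 : ℕ
  D-1 = ℕ.pred (2 * (2 + k) * (1 + k))

  -- The common denominator is D = suc D-1 = 2(n-1)(n-2), so that 1/(n-2) = w₂/D and 1/(n-1) = w₃/D.
  w₂ w₃ : ℕ
  w₂ = 2 * (2 + k)
  w₃ = 2 * (1 + k)

  frac-zero : ∀ b → frac (crown n) 0 b ≡ (ℤ.+ 0) / suc D-1
  frac-zero zero    = sym (ℚ.0/n≡0 (suc D-1))
  frac-zero (suc b) = /-cross 0 0 b D-1 refl

  frac-geodesic-two : ∀ b c → frac (crown n) ([ b ]· [ c ]· 1) (1 + k) ≡ (ℤ.+ [ b ]· [ c ]· w₂) / suc D-1
  frac-geodesic-two true  true  = /-cross 1 w₂ k D-1 (ℕ-solve k)
    where
    ℕ-solve : ∀ k → 1 * (2 * (2 + k) * (1 + k)) ≡ 2 * (2 + k) * (1 + k)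
    ℕ-solve = solve-∀
  frac-geodesic-two true  false = frac-zero (1 + k)
  frac-geodesic-two false _     = frac-zero (1 + k)

  frac-antipodal : frac (crown n) (1 + k) ((2 + k) * (1 + k)) ≡ (ℤ.+ w₃) / suc D-1
  frac-antipodal = /-cross (1 + k) w₃ _ D-1 (ℕ-solve k)
    where
    ℕ-solve : ∀ k → (1 + k) * (2 * (2 + k) * (1 + k)) ≡ 2 * (1 + k) * ((2 + k) * (1 + k))
    ℕ-solve = solve-∀

  -- D · δ_st(v), for the pairs counted in betweenness v
  contribution : Fin (n + n) → Fin (n + n) → Fin (n + n) → ℕ
  contribution v s t = [ crown n s v ]· [ crown n v t ]· w₂ + [ antipodal s t ]· w₃

  dependency-adjacent : ∀ v {s t} → s ≢ t → crown n s t ≡ true →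
    dependency (crown n) v s t ≡ (ℤ.+ 0) / suc D-1
  dependency-adjacent v {s} {t} s≢t edge = begin
    dependency (crown n) v s t                    ≡⟨ dependency-at-distance v s t 1 (Distance.dist≡1 (crown n) s≢t edge) ⟩
    frac (crown n) (#via v 1 s t) (#walks 1 s t)  ≡⟨ cong (λ a → frac (crown n) a (#walks 1 s t)) (#via-one v s t) ⟩
    frac (crown n) 0 (#walks 1 s t)               ≡⟨ frac-zero (#walks 1 s t) ⟩
    (ℤ.+ 0) / suc D-1                             ∎

  dependency-geodesic-two : ∀ v {s t} → s ≢ t → crown n s t ≡ false → #walks 2 s t ≡ 1 + k →
    dependency (crown n) v s t ≡ (ℤ.+ [ crown n s v ]· [ crown n v t ]· w₂) / suc D-1
  dependency-geodesic-two v {s} {t} s≢t no-edge two = begin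
    dependency (crown n) v s t
      ≡⟨ dependency-at-distance v s t 2 (Distance.dist≡2 (crown n) s≢t no-edge two) ⟩
    frac (crown n) (#via v 2 s t) (#walks 2 s t)        ≡⟨ cong₂ (frac (crown n)) (#via-two v s t) two ⟩
    frac (crown n) ([ crown n s v ]· [ crown n v t ]· 1) (1 + k) ≡⟨ frac-geodesic-two (crown n s v) (crown n v t) ⟩
    (ℤ.+ [ crown n s v ]· [ crown n v t ]· w₂) / suc D-1 ∎

  dependency-antipodal : ∀ v i → i ≢ index v → dependency (crown n) v (L i) (R i) ≡ (ℤ.+ w₃) / suc D-1
  dependency-antipodal v i i≢v = begin
    dependency (crown n) v (L i) (R i)                    ≡⟨ dependency-at-distance v (L i) (R i) 3 distance-three ⟩
    frac (crown n) (#via v 3 (L i) (R i)) (#walks 3 (L i) (R i))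
      ≡⟨ cong₂ (frac (crown n)) (#via-three-antipodal i v i≢v) (#walks-three-antipodal i) ⟩
    frac (crown n) (1 + k) ((2 + k) * (1 + k))            ≡⟨ frac-antipodal ⟩
    (ℤ.+ w₃) / suc D-1                                    ∎
    where
    distance-three : dist (crown n) (L i) (R i) ≡ 3
    distance-three = Distance.dist≡3 (crown n) (L≢R i i) (trans (adj-LR i i) (cong not (==-refl i)))
                                     (#walks-two-LR i i) (#walks-three-antipodal i)

  dependency-value : ∀ v s t → counted v s t ≡ true →
    dependency (crown n) v s t ≡ (ℤ.+ contribution v s t) / suc D-1
  dependency-value v s t = by-side (λ s → ∀ t → Claim s t) (λ i → by-side (Claim (L i)) (on-LL i) (on-LR i))
                                                          (λ i → by-side (Claim (R i)) (on-RL i) (on-RR i)) s t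
    where
    Claim : Fin (n + n) → Fin (n + n) → Set
    Claim s t = counted v s t ≡ true → dependency (crown n) v s t ≡ (ℤ.+ contribution v s t) / suc D-1

    over-D : ∀ {x y} → x ≡ y → (ℤ.+ x) / suc D-1 ≡ (ℤ.+ y) / suc D-1
    over-D = cong (λ x → (ℤ.+ x) / suc D-1)

    contribution-LL : ∀ i j → contribution v (L i) (L j) ≡ [ crown n (L i) v ]· [ crown n v (L j) ]· w₂
    contribution-LL i j =
      trans (cong ([ crown n (L i) v ]· [ crown n v (L j) ]· w₂ +_) (cong ([_]· w₃) (antipodal-LL i j))) (ℕ.+-identityʳ _)

    contribution-RR : ∀ i j → contribution v (R i) (R j) ≡ [ crown n (R i) v ]· [ crown n v (R j) ]· w₂
    contribution-RR i j =
      trans (cong ([ crown n (R i) v ]· [ crown n v (R j) ]· w₂ +_) (cong ([_]· w₃) (antipodal-R i (R j)))) (ℕ.+-identityʳ _)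

    on-LL : ∀ i j → Claim (L i) (L j)
    on-LL i j c = trans (dependency-geodesic-two v Li≢Lj (adj-LL i j) (#walks-two-LL i j (Li≢Lj ∘ cong L)))
                        (over-D (sym (contribution-LL i j)))
      where
      Li≢Lj : L i ≢ L j
      Li≢Lj = <ᵇ⇒≢ (counted-ordered {v = v} {L i} {L j} c)

    on-RR : ∀ i j → Claim (R i) (R j)
    on-RR i j c = trans (dependency-geodesic-two v Ri≢Rj (adj-RR i j) (#walks-two-RR i j (Ri≢Rj ∘ cong R)))
                        (over-D (sym (contribution-RR i j)))
      where
      Ri≢Rj : R i ≢ R j
      Ri≢Rj = <ᵇ⇒≢ (counted-ordered {v = v} {R i} {R j} c)

    on-RL : ∀ i j → Claim (R i) (L j)
    on-RL i j c = contradiction (trans (sym (R≮ᵇL i j)) (counted-ordered {v = v} {R i} {L j} c)) λ ()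

    contribution-LR : ∀ i j → contribution v (L i) (R j) ≡ [ i == j ]· w₃
    contribution-LR i j = cong₂ _+_ (no-two-step-across i j v w₂) (cong ([_]· w₃) (antipodal-LR i j))

    on-LR : ∀ i j → Claim (L i) (R j)
    on-LR i j c = by-equality (i Fin.≟ j)
      where
      by-equality : Dec (i ≡ j) →
        dependency (crown n) v (L i) (R j) ≡ (ℤ.+ contribution v (L i) (R j)) / suc D-1
      by-equality (no i≢j) = trans (dependency-adjacent v (L≢R i j) (trans (adj-LR i j) (cong not (==-false i≢j))))
                                   (over-D (sym (trans (contribution-LR i j) (cong ([_]· w₃) (==-false i≢j)))))
      by-equality (yes refl) = trans (dependency-antipodal v i i≢v)
                                     (over-D (sym (trans (contribution-LR i i) (cong ([_]· w₃) (==-refl i)))))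
        where
        i≢v : i ≢ index v
        i≢v = ==-false⇒≢ (not-injective (trans (sym (antipodal-avoids i v)) (counted-avoids {v = v} {L i} {R i} c)))

  neighbour-pairs : ∀ v →
    sum (λ s → sum (λ t → [ counted v s t ]· [ crown n s v ]· [ crown n v t ]· 1)) * 2 ≡ (2 + k) * (1 + k)
  neighbour-pairs v = SimpleGraph.counted-neighbour-pairs (crown n) crown-symmetric crown-irreflexive v (crown-degree v)

  antipodal-pairs : ∀ v → sum (λ s → sum (λ t → [ counted v s t ]· [ antipodal s t ]· 1)) ≡ 2 + k
  antipodal-pairs v = begin
    sum (λ s → sum (λ t → [ counted v s t ]· [ antipodal s t ]· 1))
      ≡⟨ sum-by-side (λ s → sum (λ t → [ counted v s t ]· [ antipodal s t ]· 1)) ⟩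
    sum (λ i → sum (λ t → [ counted v (L i) t ]· [ antipodal (L i) t ]· 1))
      + sum (λ i → sum (λ t → [ counted v (R i) t ]· [ antipodal (R i) t ]· 1))
      ≡⟨ cong₂ _+_ (sum-cong-≗ from-L) (sum-zero (λ i → sum-zero (from-R i))) ⟩
    sum (λ i → [ not (i == index v) ]· 1) + 0 ≡⟨ ℕ.+-identityʳ _ ⟩
    sum (λ i → [ not (i == index v) ]· 1)     ≡⟨ sum-except (index v) 1 ⟩
    (2 + k) * 1                               ≡⟨ ℕ.*-identityʳ (2 + k) ⟩
    2 + k                                     ∎
    where
    from-R : ∀ i t → [ counted v (R i) t ]· [ antipodal (R i) t ]· 1 ≡ 0
    from-R i t = trans (cong (λ b → [ counted v (R i) t ]· [ b ]· 1) (antipodal-R i t)) ([ counted v (R i) t ]·0)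
    antipode-indicator : ∀ i j → [ counted v (L i) (R j) ]· [ antipodal (L i) (R j) ]· 1 ≡ [ j == i ]· [ not (i == index v) ]· 1
    antipode-indicator i j with j Fin.≟ i
    ... | yes refl = cong₂ (λ c b → [ c ]· [ b ]· 1)
                           (trans (cong (_∧ (not (L j == v) ∧ not (R j == v))) (L<ᵇR j j)) (antipodal-avoids j v))
                           (trans (antipodal-LR j j) (==-refl j))
    ... | no  j≢i  = trans (cong (λ b → [ counted v (L i) (R j) ]· [ b ]· 1)
                                 (trans (antipodal-LR i j) (==-false (j≢i ∘ sym))))
                           ([ counted v (L i) (R j) ]·0)
    from-L : ∀ i → sum (λ t → [ counted v (L i) t ]· [ antipodal (L i) t ]· 1) ≡ [ not (i == index v) ]· 1
    from-L i = begin
      sum (λ t → [ counted v (L i) t ]· [ antipodal (L i) t ]· 1)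
        ≡⟨ sum-by-side (λ t → [ counted v (L i) t ]· [ antipodal (L i) t ]· 1) ⟩
      sum (λ j → [ counted v (L i) (L j) ]· [ antipodal (L i) (L j) ]· 1)
        + sum (λ j → [ counted v (L i) (R j) ]· [ antipodal (L i) (R j) ]· 1)
        ≡⟨ cong₂ _+_ (sum-zero (λ j → trans (cong (λ b → [ counted v (L i) (L j) ]· [ b ]· 1) (antipodal-LL i j))
                                             ([ counted v (L i) (L j) ]·0)))
                     (sum-cong-≗ (antipode-indicator i)) ⟩
      sum (λ j → [ j == i ]· [ not (i == index v) ]· 1) ≡⟨ sum-indicator i _ ⟩
      [ not (i == index v) ]· 1                           ∎

  total-contribution : ∀ v →
    sum (λ s → sum (λ t → [ counted v s t ]· contribution v s t)) * 2 ≡ (n + 1) * suc D-1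
  total-contribution v = begin
    sum (λ s → sum (λ t → [ counted v s t ]· contribution v s t)) * 2
      ≡⟨ cong (_* 2) (sum-cong-≗ (λ s → sum-cong-≗ (λ t →
           []·-distrib-weights (counted v s t) (crown n s v) (crown n v t) (antipodal s t) w₂ w₃))) ⟩
    sum (λ s → sum (λ t → through-neighbours s t * w₂ + antipodes s t * w₃)) * 2
      ≡⟨ cong (_* 2) (sum₂-linear through-neighbours antipodes w₂ w₃) ⟩
    (G * w₂ + A * w₃) * 2            ≡⟨ ℕ-solve₁ G A w₂ w₃ ⟩
    G * 2 * w₂ + A * w₃ * 2          ≡⟨ cong₂ (λ g a → g * w₂ + a * w₃ * 2) (neighbour-pairs v) (antipodal-pairs v) ⟩
    (2 + k) * (1 + k) * w₂ + (2 + k) * w₃ * 2 ≡⟨ ℕ-solve₂ k ⟩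
    (n + 1) * suc D-1                ∎
    where
    through-neighbours antipodes : Fin (n + n) → Fin (n + n) → ℕ
    through-neighbours s t = [ counted v s t ]· [ crown n s v ]· [ crown n v t ]· 1
    antipodes          s t = [ counted v s t ]· [ antipodal s t ]· 1
    G A : ℕ
    G = sum (λ s → sum (through-neighbours s))
    A = sum (λ s → sum (antipodes s))
    ℕ-solve₁ : ∀ g a x y → (g * x + a * y) * 2 ≡ g * 2 * x + a * y * 2
    ℕ-solve₁ = solve-∀
    ℕ-solve₂ : ∀ k → (2 + k) * (1 + k) * (2 * (2 + k)) + (2 + k) * (2 * (1 + k)) * 2
                   ≡ (3 + k + 1) * (2 * (2 + k) * (1 + k))
    ℕ-solve₂ = solve-∀

  crown-betweenness : ∀ v → betweenness (crown n) v ≡ (ℤ.+ (n + 1)) / 2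
  crown-betweenness v = begin
    betweenness (crown n) v
      ≡⟨ betweenness-as-fraction (crown n) v D-1 (contribution v) (dependency-value v) ⟩
    (ℤ.+ sum (λ s → sum (λ t → [ counted v s t ]· contribution v s t))) / suc D-1
      ≡⟨ /-cross (sum (λ s → sum (λ t → [ counted v s t ]· contribution v s t))) (n + 1) D-1 1
                 (total-contribution v) ⟩
    (ℤ.+ (n + 1)) / 2 ∎

open import Data.Integer using (+_)

mainTheorem5 : (n : ℕ) → 3 ≤ n → (v : Fin (n + n)) →
    betweenness (crown n) v ≡ (+ (n + 1)) / 2
mainTheorem5 _ (s≤s (s≤s (s≤s {n = k} _))) = CrownBetweenness.crown-betweenness k
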